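{- Let $h\geq 3$ and $k\geq 3h+3$ be positive integers, and let $A=[0,k+1]\setminus\{x,x+2\}$ with $x\in[1,k-2]$. (i) If $x\in[1,h-2]$, then $|h^{\wedge}A| = hk-h^2+2x+2$. (ii) If $x\in[k-h+1,k-2]$, then $|h^{\wedge}A| = (h+2)k-h^2-2x$. (iii) If $x\in\{h-1,k-h\}$, then $|h^{\wedge}A| = hk-h^2+2h-1$. (iv) If $x\in\{h,k-h-1\}$, then $|h^{\wedge}A| = hk-h^2+2h$. (v) If $x\in[h+1,k-h-2]$, then $|h^{\wedge}A| = hk-h^2+2h+1$.
   Context: For a finite set $A$ of integers and a positive integer $h\le |A|$, the restricted $h$-fold sumset $h^{\wedge}A$ is the set of all sums of $h$ distinct elements of $A$. For integers $\alpha\le\beta$, $[\alpha,\beta]=\{x\in\mathbb{Z}:\alpha\le x\le\beta\}$. -}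

module Defs where

open import Data.Nat using (ℕ; zero; suc; _+_; _≟_)
open import Data.List using (List; []; _∷_; [_]; map; _++_; length; filter; upTo; deduplicate)
open import Relation.Nullary.Decidable using (¬?; _×-dec_)
open import Data.Nat.ListAction using (sum)

interval : ℕ → ℕ → List ℕ
interval α β = filter (λ y → α Data.Nat.≤? y) (upTo (suc β))

-- All sub-lists of length h of a list (= all h-element subsets when the
-- list is duplicate-free), i.e. all choices of h distinct entries.
choose : ℕ → List ℕ → List (List ℕ)
choose zero    _        = [ [] ]
choose (suc h) []       = []
choose (suc h) (a ∷ as) = map (a ∷_) (choose h as) ++ choose (suc h) as

restrictedSumset : ℕ → List ℕ → List ℕ
restrictedSumset h A = deduplicate _≟_ (map sum (choose h A))

card-hA : ℕ → List ℕ → ℕ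
card-hA h A = length (restrictedSumset h A)

setA : ℕ → ℕ → List ℕ
setA k x = filter (λ y → ¬? (y ≟ x) ×-dec ¬? (y ≟ x + 2)) (interval 0 (k + 1))

{-# OPTIONS --safe #-}
-- Every sum of h distinct elements of A lies between tri h = 0 + 1 + ⋯ + (h - 1) and
-- h (k + 1) - tri h, the latter by the reflection y ↦ k + 1 - y.  Conversely, the h-sets
-- made of i elements below x, possibly x + 1, and j elements above x + 2 realise a whole
-- interval of sums; listed by increasing j, consecutive intervals overlap and the last one
-- ends at h (k + 1) - tri h.  So the sumset contains everything from its least element up
-- to h (k + 1) - tri h except for gaps near the bottom, and these are found by adjoining the
-- missing elements x and x + 2 to an h-set and comparing its sum with tri.  Part (ii) and the
-- second halves of (iii) and (iv) follow from (i), (iii) and (iv) because the reflection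
-- maps setA k x onto setA k (k - 1 - x).
module Submission where

open import Defs
open import Data.Nat using (ℕ; _≤_; _∸_)
open import Data.Integer using (ℤ; +_; _-_)
open import Data.Product using (_×_)
open import Data.Sum using (_⊎_)
open import Relation.Binary.PropositionalEquality using (_≡_)

import Data.Integer as ℤ
import Data.Integer.Properties as ℤₚ
import Data.Integer.Tactic.RingSolver as ℤ-Solver
open import Data.List using (List; []; _∷_; [_]; _++_; length; map; upTo)
open import Data.List.Membership.DecPropositional Data.Nat._≟_ using (_∈?_)
open import Data.List.Membership.Propositional using (_∈_; _∉_; find)
open import Data.List.Membership.Propositional.Properties
  using (∈-∃++; ∈-++⁻; ∈-++⁺ˡ; ∈-++⁺ʳ; ∈-map⁺; ∈-map⁻; ∈-deduplicate⁻; ∈-deduplicate⁺;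
         ∈-upTo⁺; ∈-upTo⁻; ∈-filter⁺; ∈-filter⁻)
open import Data.List.Membership.Propositional.Properties.WithK using (unique∧set⇒bag)
open import Data.List.Properties using (length-map; length-upTo; length-++)
open import Data.List.Relation.Binary.BagAndSetEquality using (∼bag⇒↭)
open import Data.List.Relation.Binary.Permutation.Propositional
  using (_↭_; ↭⇒↭ₛ; prep; ↭-refl; ↭-sym; ↭-trans)
open import Data.List.Relation.Binary.Permutation.Propositional.Properties
  using (shift; ↭-length; ∈-resp-↭; All-resp-↭)
import Data.List.Relation.Binary.Permutation.Setoid.Properties as Setoid↭
open import Data.List.Relation.Binary.Subset.Propositional using (_⊆_)
open import Data.List.Relation.Unary.All as All using (All; []; _∷_)
import Data.List.Relation.Unary.All.Properties as All
open import Data.List.Relation.Unary.Any using (here; there; any?)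
open import Data.List.Relation.Unary.Unique.DecPropositional.Properties Data.Nat._≟_
  using (deduplicate-!)
open import Data.List.Relation.Unary.Unique.Propositional using (Unique; []; _∷_)
import Data.List.Relation.Unary.Unique.Propositional.Properties as Unique
open import Data.Nat using (zero; suc; _+_; _*_; _<_; z≤n; s≤s; s≤s⁻¹; _≤?_; _≟_)
open import Data.Nat.ListAction using (sum)
open import Data.Nat.ListAction.Properties using (sum-↭; sum-++)
open import Data.Nat.Properties
open import Algebra.Properties.CommutativeSemigroup +-commutativeSemigroup using (interchange; xy∙z≈xz∙y)
open import Data.Nat.Tactic.RingSolver using (solve-∀)
open import Data.Product using (∃-syntax; _,_; proj₁; proj₂; uncurry)
open import Data.Sum using (inj₁; inj₂; [_,_]′)
open import Function using (_⇔_; _∘_; case_of_; mk⇔; Equivalence)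
open import Level using (0ℓ)
open import Relation.Binary.PropositionalEquality
  using (refl; sym; trans; cong; cong₂; subst; setoid; _≢_; ≢-sym; module ≡-Reasoning)
open import Relation.Nullary using (yes; no; ¬_; contradiction)
open import Relation.Nullary.Decidable using (¬?; _×-dec_)
open import Relation.Unary using (Pred; _∪_)

Unique-↭ : ∀ {xs ys : List ℕ} → xs ↭ ys → Unique xs → Unique ys
Unique-↭ p = Setoid↭.Unique-resp-↭ (setoid ℕ) (↭⇒↭ₛ p)

unique∧set⇒length≡ : ∀ {xs ys : List ℕ} → Unique xs → Unique ys →
                      (∀ {z} → z ∈ xs ⇔ z ∈ ys) → length xs ≡ length ys
unique∧set⇒length≡ uxs uys xs⇔ys = ↭-length (∼bag⇒↭ (unique∧set⇒bag uxs uys xs⇔ys))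

∈⇒↭∷ : ∀ {z} {xs : List ℕ} → z ∈ xs → ∃[ ys ] xs ↭ z ∷ ys
∈⇒↭∷ {z} z∈xs with ys , zs , refl ← ∈-∃++ z∈xs = ys ++ zs , shift z ys zs

⊆-∷⁻ : ∀ {A : Set} {a : A} {as cs} → cs ⊆ a ∷ as → a ∉ cs → cs ⊆ as
⊆-∷⁻ cs⊆ a∉cs y∈cs with cs⊆ y∈cs
... | here refl  = contradiction y∈cs a∉cs
... | there y∈as = y∈as

tri : ℕ → ℕ
tri zero    = 0
tri (suc n) = n + tri n

tri-double : ∀ n → tri n + tri n + n ≡ n * n
tri-double zero    = refl
tri-double (suc n) = begin
  n + tri n + (n + tri n) + suc n  ≡⟨ regroup n (tri n) ⟩
  tri n + tri n + n + (n + n + 1)  ≡⟨ cong (_+ (n + n + 1)) (tri-double n) ⟩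
  n * n + (n + n + 1)              ≡⟨ square n ⟩
  suc n * suc n                    ∎
  where
  open ≡-Reasoning
  regroup : ∀ n t → n + t + (n + t) + suc n ≡ t + t + n + (n + n + 1)
  regroup = solve-∀
  square : ∀ n → n * n + (n + n + 1) ≡ suc n * suc n
  square = solve-∀

tri-+ : ∀ m n → tri (m + n) ≡ tri m + tri n + m * n
tri-+ zero    n = sym (+-identityʳ (tri n))
tri-+ (suc m) n = trans (cong (_+_ (m + n)) (tri-+ m n)) (regroup m n (tri m) (tri n))
  where
  regroup : ∀ m n a b → m + n + (a + b + m * n) ≡ m + a + b + suc m * n
  regroup = solve-∀

Unique∧All<⇒length≤ : ∀ m {xs} → Unique xs → All (_< m) xs → length xs ≤ m
Unique∧All<⇒length≤ zero    _ []                 = z≤n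
Unique∧All<⇒length≤ (suc m) {xs} uxs xs<1+m with m ∈? xs
... | no m∉xs = m≤n⇒m≤1+n (Unique∧All<⇒length≤ m uxs (All.tabulate below-m))
  where
  below-m : ∀ {y} → y ∈ xs → y < m
  below-m y∈xs = ≤∧≢⇒< (s≤s⁻¹ (All.lookup xs<1+m y∈xs)) λ { refl → m∉xs y∈xs }
... | yes m∈xs with ys , p ← ∈⇒↭∷ m∈xs
  with m∉ys ∷ uys ← Unique-↭ p uxs | _ ∷ ys<1+m ← All-resp-↭ p xs<1+m =
  ≤-trans (≤-reflexive (↭-length p)) (s≤s (Unique∧All<⇒length≤ m uys
    (All.zipWith (λ (y<1+m , m≢y) → ≤∧≢⇒< (s≤s⁻¹ y<1+m) (≢-sym m≢y)) (ys<1+m , m∉ys))))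

Unique⇒∃≥ : ∀ n {xs} → Unique xs → length xs ≡ suc n → ∃[ z ] z ∈ xs × n ≤ z
Unique⇒∃≥ n {xs} uxs len with any? (n ≤?_) xs
... | yes ∃n≤ = find ∃n≤
... | no ∄n≤ = contradiction (Unique∧All<⇒length≤ n uxs (All.map ≰⇒> (All.¬Any⇒All¬ xs ∄n≤)))
                             (<⇒≱ (≤-reflexive (sym len)))

tri≤sum : ∀ {xs} → Unique xs → tri (length xs) ≤ sum xs
tri≤sum uxs = go _ uxs refl
  where
  go : ∀ n {xs} → Unique xs → length xs ≡ n → tri n ≤ sum xs
  go zero    _ _ = z≤n
  go (suc n) {xs} uxs len
    with z , z∈xs , n≤z ← Unique⇒∃≥ n uxs len
    with ys , p ← ∈⇒↭∷ z∈xs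
    with _ ∷ uys ← Unique-↭ p uxs = begin
      n + tri n   ≤⟨ +-mono-≤ n≤z (go n uys (suc-injective (trans (sym (↭-length p)) len))) ⟩
      z + sum ys  ≡⟨ sum-↭ p ⟨
      sum xs      ∎
    where open ≤-Reasoning

-- The only n distinct naturals with sum tri n + 1 are 0, 1, …, n - 2 and n.
sum≡tri+1⇒length∈ : ∀ {xs} → Unique xs → sum xs ≡ tri (length xs) + 1 → length xs ∈ xs
sum≡tri+1⇒length∈ uxs = go _ uxs refl
  where
  go : ∀ n {xs} → Unique xs → length xs ≡ n → sum xs ≡ tri n + 1 → n ∈ xs
  go zero    {[]} _ _ ()
  go (suc n) {xs} uxs len sum≡
    with z , z∈xs , n≤z ← Unique⇒∃≥ n uxs len
    with ys , p ← ∈⇒↭∷ z∈xs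
    with z∉ys ∷ uys ← Unique-↭ p uxs
    with len-ys ← suc-injective (trans (sym (↭-length p)) len)
    with m≤n⇒m<n∨m≡n n≤z
  ... | inj₂ refl = contradiction n∈ys λ n∈ys → All.lookup z∉ys n∈ys refl
    where
    n∈ys : n ∈ ys
    n∈ys = go n uys len-ys (+-cancelˡ-≡ n _ _ (begin
      n + sum ys       ≡⟨ sum-↭ p ⟨
      sum xs           ≡⟨ sum≡ ⟩
      n + tri n + 1    ≡⟨ +-assoc n (tri n) 1 ⟩
      n + (tri n + 1)  ∎))
      where open ≡-Reasoning
  ... | inj₁ n<z = subst (_∈ xs) (≤-antisym z≤1+n n<z) z∈xs
    where
    open ≤-Reasoning
    z≤1+n : z ≤ suc n
    z≤1+n = +-cancelʳ-≤ (tri n) z (suc n) (begin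
      z + tri n      ≤⟨ +-monoʳ-≤ z (subst (λ m → tri m ≤ sum ys) len-ys (tri≤sum uys)) ⟩
      z + sum ys     ≡⟨ sum-↭ p ⟨
      sum xs         ≡⟨ sum≡ ⟩
      n + tri n + 1  ≡⟨ +-comm (n + tri n) 1 ⟩
      suc n + tri n  ∎)

sum-map-∸ : ∀ K {xs} → All (_≤ K) xs → sum (map (K ∸_) xs) + sum xs ≡ length xs * K
sum-map-∸ K []                   = refl
sum-map-∸ K {x ∷ xs} (x≤K ∷ xs≤K) = begin
  K ∸ x + sum (map (K ∸_) xs) + (x + sum xs)    ≡⟨ interchange (K ∸ x) _ x _ ⟩
  (K ∸ x + x) + (sum (map (K ∸_) xs) + sum xs)  ≡⟨ cong₂ _+_ (m∸n+n≡m x≤K) (sum-map-∸ K xs≤K) ⟩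
  K + length xs * K                             ∎
  where open ≡-Reasoning

Unique-map-∸ : ∀ K {xs} → All (_≤ K) xs → Unique xs → Unique (map (K ∸_) xs)
Unique-map-∸ K []                   []             = []
Unique-map-∸ K {x ∷ xs} (x≤K ∷ xs≤K) (x∉xs ∷ uxs) =
  All.map⁺ (All.zipWith (λ (y≤K , x≢y) eq → x≢y (∸-cancelˡ-≡ x≤K y≤K eq)) (xs≤K , x∉xs))
    ∷ Unique-map-∸ K xs≤K uxs

record Selection (P : Pred ℕ 0ℓ) (h t : ℕ) : Set where
  constructor selection
  field
    elements : List ℕ
    distinct : Unique elements
    valid    : All P elements
    size     : length elements ≡ h
    total    : sum elements ≡ t

∈-choose⁻ : ∀ h {A cs} → Unique A → cs ∈ choose h A → Unique cs × cs ⊆ A × length cs ≡ h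
∈-choose⁻ zero    _ (here refl) = [] , (λ ()) , refl
∈-choose⁻ (suc h) {a ∷ as} {cs} (a∉as ∷ uas) cs∈ with ∈-++⁻ (map (a ∷_) (choose h as)) cs∈
... | inj₂ cs∈′ with ucs , cs⊆as , len ← ∈-choose⁻ (suc h) uas cs∈′ = ucs , there ∘ cs⊆as , len
... | inj₁ cs∈′
  with cs′ , cs′∈ , refl ← ∈-map⁻ (a ∷_) cs∈′
  with ucs′ , cs′⊆as , len ← ∈-choose⁻ h uas cs′∈ =
  All.tabulate (All.lookup a∉as ∘ cs′⊆as) ∷ ucs′ ,
  (λ { (here refl) → here refl ; (there y∈) → there (cs′⊆as y∈) }) ,
  cong suc len

∈-choose⁺ : ∀ A {cs} → Unique cs → cs ⊆ A → ∃[ ls ] ls ∈ choose (length cs) A × ls ↭ cs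
∈-choose⁺ A        {[]}    _ _ = [] , here refl , ↭-refl
∈-choose⁺ []       {_ ∷ _} _ cs⊆[] with () ← cs⊆[] (here refl)
∈-choose⁺ (a ∷ as) {cs@(_ ∷ _)} ucs cs⊆A with a ∈? cs
... | no a∉cs with ls , ls∈ , ls↭cs ← ∈-choose⁺ as ucs (⊆-∷⁻ cs⊆A a∉cs) = ls , ∈-++⁺ʳ _ ls∈ , ls↭cs
... | yes a∈cs
  with ys , p ← ∈⇒↭∷ a∈cs
  with a∉ys ∷ uys ← Unique-↭ p ucs
  with ls , ls∈ , ls↭ys ← ∈-choose⁺ as uys
                            (⊆-∷⁻ (cs⊆A ∘ ∈-resp-↭ (↭-sym p) ∘ there) (All.All¬⇒¬Any a∉ys)) =
  a ∷ ls ,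
  subst (λ n → a ∷ ls ∈ choose n (a ∷ as)) (sym (↭-length p)) (∈-++⁺ˡ (∈-map⁺ (a ∷_) ls∈)) ,
  ↭-trans (prep a ls↭ys) (↭-sym p)

∈-restrictedSumset⁻ : ∀ {h A t} → Unique A → t ∈ restrictedSumset h A → Selection (_∈ A) h t
∈-restrictedSumset⁻ {h} {A} uA t∈
  with cs , cs∈ , refl ← ∈-map⁻ sum (∈-deduplicate⁻ _≟_ (map sum (choose h A)) t∈)
  with ucs , cs⊆A , len ← ∈-choose⁻ h uA cs∈ = selection cs ucs (All.tabulate cs⊆A) len refl

∈-restrictedSumset⁺ : ∀ {h A t} → Selection (_∈ A) h t → t ∈ restrictedSumset h A
∈-restrictedSumset⁺ {A = A} (selection cs ucs cs⊆A refl refl)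
  with ls , ls∈ , ls↭cs ← ∈-choose⁺ A ucs (All.lookup cs⊆A) =
  ∈-deduplicate⁺ _≟_ (subst (_∈ map sum (choose (length cs) A)) (sum-↭ ls↭cs) (∈-map⁺ sum ls∈))

Selection-singleton : ∀ {P : Pred ℕ 0ℓ} {a} → P a → Selection P 1 a
Selection-singleton {a = a} Pa = selection [ a ] ([] ∷ []) (Pa ∷ []) refl (+-identityʳ a)

Selection-∷ : ∀ {P : Pred ℕ 0ℓ} {h t v} → ¬ P v → Selection P h t →
              Selection (P ∪ (_≡ v)) (suc h) (v + t)
Selection-∷ ¬Pv (selection cs ucs vs refl refl) =
  selection (_ ∷ cs) (All.map (λ Py → λ { refl → ¬Pv Py }) vs ∷ ucs) (inj₂ refl ∷ All.map inj₁ vs)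
    refl refl

module _ {P Q : Pred ℕ 0ℓ} where

  Selection-map : ∀ {h t} → (∀ {y} → P y → Q y) → Selection P h t → Selection Q h t
  Selection-map P⇒Q (selection cs ucs vs len tot) = selection cs ucs (All.map P⇒Q vs) len tot

  Selection-++ : ∀ {i j s u} → (∀ {y z} → P y → Q z → y < z) →
                 Selection P i s → Selection Q j u → Selection (P ∪ Q) (i + j) (s + u)
  Selection-++ P<Q (selection cs₁ u₁ v₁ refl refl) (selection cs₂ u₂ v₂ refl refl) =
    selection (cs₁ ++ cs₂)
      (Unique.++⁺ u₁ u₂ λ (y∈cs₁ , y∈cs₂) →
         <-irrefl refl (P<Q (All.lookup v₁ y∈cs₁) (All.lookup v₂ y∈cs₂)))
      (All.++⁺ (All.map inj₁ v₁) (All.map inj₂ v₂)) (length-++ cs₁) (sum-++ cs₁ cs₂)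

Selection-tri≤ : ∀ {P h t} → Selection P h t → tri h ≤ t
Selection-tri≤ (selection cs ucs _ refl refl) = tri≤sum ucs

Selection-sum≡tri+1⇒P : ∀ {P h t} → Selection P h t → t ≡ tri h + 1 → P h
Selection-sum≡tri+1⇒P (selection cs ucs vs refl refl) t≡ = All.lookup vs (sum≡tri+1⇒length∈ ucs t≡)

module _ {P : Pred ℕ 0ℓ} (K : ℕ) (P⇒≤K : ∀ {y} → P y → y ≤ K) where

  Selection-reflect : ∀ {Q : Pred ℕ 0ℓ} {h t} → (∀ {y} → P y → Q (K ∸ y)) →
                      Selection P h t → Selection Q h (h * K ∸ t)
  Selection-reflect P⇒Q (selection cs ucs vs refl refl) =
    selection (map (K ∸_) cs) (Unique-map-∸ K cs≤K ucs) (All.map⁺ (All.map P⇒Q vs)) (length-map _ cs)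
      (sym (trans (cong (_∸ sum cs) (sym (sum-map-∸ K cs≤K))) (m+n∸n≡m _ (sum cs))))
    where
    cs≤K : All (_≤ K) cs
    cs≤K = All.map P⇒≤K vs

  Selection-sum+tri≤ : ∀ {h t} → Selection P h t → t + tri h ≤ h * K
  Selection-sum+tri≤ (selection cs ucs vs refl refl) = begin
    sum cs + tri (length cs)   ≡⟨ cong (λ n → sum cs + tri n) (length-map (K ∸_) cs) ⟨
    sum cs + tri (length cs′)  ≤⟨ +-monoʳ-≤ (sum cs) (tri≤sum (Unique-map-∸ K cs≤K ucs)) ⟩
    sum cs + sum cs′           ≡⟨ +-comm (sum cs) _ ⟩
    sum cs′ + sum cs           ≡⟨ sum-map-∸ K cs≤K ⟩
    length cs * K              ∎
    where
    open ≤-Reasoning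
    cs′ : List ℕ
    cs′ = map (K ∸_) cs
    cs≤K : All (_≤ K) cs
    cs≤K = All.map P⇒≤K vs

card-hA≡length : ∀ {h A T} → Unique T → (∀ {t} → t ∈ restrictedSumset h A ⇔ t ∈ T) →
                 card-hA h A ≡ length T
card-hA≡length uT sums⇔T = unique∧set⇒length≡ (deduplicate-! _) uT sums⇔T

[_,_⟩ : ℕ → ℕ → Pred ℕ 0ℓ
[ a , b ⟩ y = a ≤ y × y < b

[,⟩-mono : ∀ {a a′ b b′ y} → a′ ≤ a → b ≤ b′ → [ a , b ⟩ y → [ a′ , b′ ⟩ y
[,⟩-mono a′≤a b≤b′ (a≤y , y<b) = ≤-trans a′≤a a≤y , <-≤-trans y<b b≤b′

[,⟩-< : ∀ {a b c d y z} → b ≤ c → [ a , b ⟩ y → [ c , d ⟩ z → y < z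
[,⟩-< b≤c (_ , y<b) (c≤z , _) = <-≤-trans y<b (≤-trans b≤c c≤z)

[,⟩-∪ : ∀ {a b c y} → a ≤ b → b ≤ c → ([ a , b ⟩ ∪ [ b , c ⟩) y → [ a , c ⟩ y
[,⟩-∪ a≤b b≤c (inj₁ y∈) = [,⟩-mono ≤-refl b≤c y∈
[,⟩-∪ a≤b b≤c (inj₂ y∈) = [,⟩-mono a≤b ≤-refl y∈

range : ℕ → ℕ → List ℕ
range a n = map (_+_ a) (upTo n)

Unique-range : ∀ a n → Unique (range a n)
Unique-range a n = Unique.map⁺ (+-cancelˡ-≡ a _ _) (Unique.upTo⁺ n)

length-range : ∀ a n → length (range a n) ≡ n
length-range a n = trans (length-map (_+_ a) (upTo n)) (length-upTo n)

∈-range⁻ : ∀ {a n t} → t ∈ range a n → [ a , a + n ⟩ t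
∈-range⁻ {a} t∈ with i , i∈ , refl ← ∈-map⁻ (_+_ a) t∈ = m≤m+n a i , +-monoʳ-< a (∈-upTo⁻ i∈)

∈-range⁺ : ∀ {a n t} → [ a , a + n ⟩ t → t ∈ range a n
∈-range⁺ {a} {n} {t} (a≤t , t<a+n) = subst (_∈ range a n) (m+[n∸m]≡n a≤t)
  (∈-map⁺ (_+_ a) (∈-upTo⁺ (+-cancelˡ-< a _ _ (subst (_< a + n) (sym (m+[n∸m]≡n a≤t)) t<a+n))))

card-hA-range : ∀ h A {lo n} → (∀ {t} → t ∈ restrictedSumset h A ⇔ [ lo , lo + n ⟩ t) → card-hA h A ≡ n
card-hA-range h A {lo} {n} sums⇔ =
  trans (card-hA≡length {h} {A} (Unique-range lo n)
                        (mk⇔ (∈-range⁺ ∘ Equivalence.to sums⇔) (Equivalence.from sums⇔ ∘ ∈-range⁻)))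
        (length-range lo n)

card-hA-point+range : ∀ h A {a n} →
                      (∀ {t} → t ∈ restrictedSumset h A ⇔ (t ≡ a ⊎ [ a + 2 , a + 2 + n ⟩ t)) →
                      card-hA h A ≡ suc n
card-hA-point+range h A {a} {n} sums⇔ =
  trans (card-hA≡length {h} {A} (a∉range ∷ Unique-range (a + 2) n)
                        (mk⇔ (to ∘ Equivalence.to sums⇔) (Equivalence.from sums⇔ ∘ from)))
        (cong suc (length-range (a + 2) n))
  where
  a∉range : All (a ≢_) (range (a + 2) n)
  a∉range = All.tabulate (λ t∈ → <⇒≢ (<-≤-trans (m<m+n a (s≤s z≤n)) (proj₁ (∈-range⁻ t∈))))
  to : ∀ {t} → t ≡ a ⊎ [ a + 2 , a + 2 + n ⟩ t → t ∈ a ∷ range (a + 2) n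
  to (inj₁ refl) = here refl
  to (inj₂ t∈)   = there (∈-range⁺ t∈)
  from : ∀ {t} → t ∈ a ∷ range (a + 2) n → t ≡ a ⊎ [ a + 2 , a + 2 + n ⟩ t
  from (here refl) = inj₁ refl
  from (there t∈)  = inj₂ (∈-range⁻ t∈)

Covers : Pred ℕ 0ℓ → ℕ → ℕ → ℕ → Set
Covers P h lo hi = ∀ {t} → lo ≤ t → t ≤ hi → Selection P h t

Covers-offsets : ∀ {P h lo w} → (∀ {d} → d ≤ w → Selection P h (lo + d)) → Covers P h lo (lo + w)
Covers-offsets {lo = lo} sel {t} lo≤t t≤lo+w =
  subst (Selection _ _) (m+[n∸m]≡n lo≤t) (sel (m≤n+o⇒m∸n≤o t lo t≤lo+w))

Covers-singleton : ∀ {P : Pred ℕ 0ℓ} {a} → P a → Covers P 1 a a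
Covers-singleton Pa a≤t t≤a = subst (Selection _ 1) (≤-antisym a≤t t≤a) (Selection-singleton Pa)

Covers-map : ∀ {P Q : Pred ℕ 0ℓ} {h lo hi} → (∀ {y} → P y → Q y) → Covers P h lo hi → Covers Q h lo hi
Covers-map P⇒Q cov lo≤t t≤hi = Selection-map P⇒Q (cov lo≤t t≤hi)

Covers-join : ∀ {P h lo₁ hi₁ lo₂ hi₂} → lo₂ ≤ suc hi₁ →
              Covers P h lo₁ hi₁ → Covers P h lo₂ hi₂ → Covers P h lo₁ hi₂
Covers-join {hi₁ = hi₁} lo₂≤1+hi₁ cov₁ cov₂ {t} lo₁≤t t≤hi₂ with t ≤? hi₁
... | yes t≤hi₁ = cov₁ lo₁≤t t≤hi₁
... | no  t≰hi₁ = cov₂ (≤-trans lo₂≤1+hi₁ (≰⇒> t≰hi₁)) t≤hi₂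

Covers-++ : ∀ {P Q : Pred ℕ 0ℓ} {i j lo₁ hi₁ lo₂ hi₂} → (∀ {y z} → P y → Q z → y < z) →
            lo₁ ≤ hi₁ → lo₂ ≤ hi₂ → Covers P i lo₁ hi₁ → Covers Q j lo₂ hi₂ →
            Covers (P ∪ Q) (i + j) (lo₁ + lo₂) (hi₁ + hi₂)
Covers-++ {lo₁ = lo₁} {hi₁} {lo₂} P<Q lo₁≤hi₁ lo₂≤hi₂ cov₁ cov₂ {t} lo≤t t≤hi with t ≤? hi₁ + lo₂
... | yes t≤hi₁+lo₂ = subst (Selection _ _) (m∸n+n≡m (m+n≤o⇒n≤o lo₁ lo≤t))
        (Selection-++ P<Q (cov₁ (m+n≤o⇒m≤o∸n lo₁ lo≤t) t∸lo₂≤hi₁) (cov₂ ≤-refl lo₂≤hi₂))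
  where
  t∸lo₂≤hi₁ : t ∸ lo₂ ≤ hi₁
  t∸lo₂≤hi₁ = m≤n+o⇒m∸n≤o t lo₂ (subst (t ≤_) (+-comm hi₁ lo₂) t≤hi₁+lo₂)
... | no t≰hi₁+lo₂ = subst (Selection _ _) (m+[n∸m]≡n (m+n≤o⇒m≤o hi₁ hi₁+lo₂≤t))
        (Selection-++ P<Q (cov₁ lo₁≤hi₁ ≤-refl) (cov₂ lo₂≤t∸hi₁ (m≤n+o⇒m∸n≤o t hi₁ t≤hi)))
  where
  hi₁+lo₂≤t : hi₁ + lo₂ ≤ t
  hi₁+lo₂≤t = <⇒≤ (≰⇒> t≰hi₁+lo₂)
  lo₂≤t∸hi₁ : lo₂ ≤ t ∸ hi₁
  lo₂≤t∸hi₁ = m+n≤o⇒m≤o∸n lo₂ (subst (_≤ t) (+-comm hi₁ lo₂) hi₁+lo₂≤t)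

-- Either the bottom element a is used and j - 1 elements above it realise the offset d,
-- or j elements of the shorter interval [a + 1, …⟩ realise the offset d - j.
[,⟩-selection : ∀ a j e {d} → d ≤ j * e → Selection [ a , a + j + e ⟩ j (a * j + tri j + d)
[,⟩-selection a zero e z≤n = selection [] [] [] refl (sym (cong (λ m → m + 0 + 0) (*-zeroʳ a)))
[,⟩-selection a (suc j) e {d} d≤ with d ≤? j * e
... | yes d≤je = subst (Selection _ _) (with-bottom a j (tri j) d)
  (Selection-map ([,⟩-mono ≤-refl (≤-reflexive (cong (_+ e) (sym (+-suc a j))))
                   ∘ [,⟩-∪ (n≤1+n a) (≤-trans (m≤m+n (suc a) j) (m≤m+n _ e)))
    (Selection-++ ([,⟩-< ≤-refl) (Selection-singleton (≤-refl , ≤-refl)) ([,⟩-selection (suc a) j e d≤je)))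
  where
  with-bottom : ∀ a j t d → a + (suc a * j + t + d) ≡ a * suc j + (j + t) + d
  with-bottom = solve-∀
[,⟩-selection a (suc j) zero    d≤ | no d≰je = contradiction d≤ d≰je
[,⟩-selection a (suc j) (suc e) d≤ | no d≰je
  with d′ , refl ← m≤n⇒∃[o]m+o≡n (≤-trans (s≤s (m≤m*n j (suc e))) (≰⇒> d≰je)) =
  subst (Selection _ _) (without-bottom a j (tri j) d′)
    (Selection-map ([,⟩-mono (n≤1+n a) (≤-reflexive (sym (+-suc (a + suc j) e))))
      ([,⟩-selection (suc a) (suc j) e
         (+-cancelˡ-≤ (suc j) _ _ (≤-trans d≤ (≤-reflexive (*-suc (suc j) e))))))
  where
  without-bottom : ∀ a j t d → suc a * suc j + (j + t) + d ≡ a * suc j + (j + t) + (suc j + d)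
  without-bottom = solve-∀

Covers-[,⟩ : ∀ a j e → Covers [ a , a + j + e ⟩ j (a * j + tri j) (a * j + tri j + j * e)
Covers-[,⟩ a j e = Covers-offsets ([,⟩-selection a j e)

∈-setA⁻ : ∀ {k x y} → y ∈ setA k x → y ≤ k + 1 × y ≢ x × y ≢ x + 2
∈-setA⁻ {k} {x} y∈
  with y∈interval , y≢x , y≢x+2 ← ∈-filter⁻ (λ y → ¬? (y ≟ x) ×-dec ¬? (y ≟ x + 2)) y∈ =
  s≤s⁻¹ (∈-upTo⁻ (proj₁ (∈-filter⁻ (0 ≤?_) {xs = upTo (suc (k + 1))} y∈interval))) , y≢x , y≢x+2

∈-setA⁺ : ∀ {k x y} → y ≤ k + 1 → y ≢ x → y ≢ x + 2 → y ∈ setA k x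
∈-setA⁺ {k} {x} y≤k+1 y≢x y≢x+2 =
  ∈-filter⁺ (λ y → ¬? (y ≟ x) ×-dec ¬? (y ≟ x + 2))
    (∈-filter⁺ (0 ≤?_) (∈-upTo⁺ (s≤s y≤k+1)) z≤n) (y≢x , y≢x+2)

Unique-setA : ∀ k x → Unique (setA k x)
Unique-setA k x = Unique.filter⁺ (λ y → ¬? (y ≟ x) ×-dec ¬? (y ≟ x + 2))
                    (Unique.filter⁺ (0 ≤?_) (Unique.upTo⁺ (suc (k + 1))))

∸≡⇒+≡ : ∀ {K y z} → y ≤ K → K ∸ y ≡ z → z + y ≡ K
∸≡⇒+≡ y≤K refl = m∸n+n≡m y≤K

∈-setA-reflect : ∀ {k x x′ y} → x + x′ + 1 ≡ k → y ∈ setA k x → k + 1 ∸ y ∈ setA k x′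
∈-setA-reflect {x = x} {x′} {y} refl y∈ with y≤ , y≢x , y≢x+2 ← ∈-setA⁻ y∈ =
  ∈-setA⁺ (m∸n≤m _ y)
    (λ eq → y≢x+2 (+-cancelˡ-≡ x′ y (x + 2) (trans (∸≡⇒+≡ y≤ eq) (split₁ x x′))))
    (λ eq → y≢x (+-cancelˡ-≡ (x′ + 2) y x (trans (∸≡⇒+≡ y≤ eq) (split₂ x x′))))
  where
  split₁ : ∀ x x′ → x + x′ + 1 + 1 ≡ x′ + (x + 2)
  split₁ = solve-∀
  split₂ : ∀ x x′ → x + x′ + 1 + 1 ≡ x′ + 2 + x
  split₂ = solve-∀

card-hA-reflect : ∀ h k x x′ → x + x′ + 1 ≡ k → card-hA h (setA k x) ≡ card-hA h (setA k x′)
card-hA-reflect h k x x′ x+x′+1≡k = begin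
  card-hA h (setA k x)    ≡⟨ card-hA≡length {h} {setA k x} unique-reflected (mk⇔ to from) ⟩
  length (map (M ∸_) S′)  ≡⟨ length-map (M ∸_) S′ ⟩
  card-hA h (setA k x′)   ∎
  where
  open ≡-Reasoning
  M : ℕ
  M = h * (k + 1)
  S′ : List ℕ
  S′ = restrictedSumset h (setA k x′)
  sums⁻ : ∀ z {t} → t ∈ restrictedSumset h (setA k z) → Selection (_∈ setA k z) h t
  sums⁻ z = ∈-restrictedSumset⁻ (Unique-setA k z)
  ≤M : ∀ z {t} → Selection (_∈ setA k z) h t → t ≤ M
  ≤M z sel = m+n≤o⇒m≤o _ (Selection-sum+tri≤ (k + 1) (proj₁ ∘ ∈-setA⁻ {k} {z}) sel)
  reflect : ∀ z z′ {t} → z + z′ + 1 ≡ k → t ∈ restrictedSumset h (setA k z) →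
            M ∸ t ∈ restrictedSumset h (setA k z′)
  reflect z z′ eq t∈ = ∈-restrictedSumset⁺
    (Selection-reflect (k + 1) (proj₁ ∘ ∈-setA⁻ {k} {z}) (∈-setA-reflect {k} {z} {z′} eq) (sums⁻ z t∈))
  unique-reflected : Unique (map (M ∸_) S′)
  unique-reflected = Unique-map-∸ M (All.tabulate (≤M x′ ∘ sums⁻ x′)) (deduplicate-! _)
  to : ∀ {t} → t ∈ restrictedSumset h (setA k x) → t ∈ map (M ∸_) S′
  to t∈ = subst (_∈ map (M ∸_) S′) (m∸[m∸n]≡n (≤M x (sums⁻ x t∈)))
                (∈-map⁺ (M ∸_) (reflect x x′ x+x′+1≡k t∈))
  from : ∀ {t} → t ∈ map (M ∸_) S′ → t ∈ restrictedSumset h (setA k x)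
  from t∈ with s , s∈ , refl ← ∈-map⁻ (M ∸_) t∈ =
    reflect x′ x (trans (cong (_+ 1) (+-comm x′ x)) x+x′+1≡k) s∈

≤-from-excess : ∀ {a b v} → 1 ≤ v → a + v ≡ suc b → a ≤ b
≤-from-excess {a} 1≤v eq = s≤s⁻¹ (subst (a <_) eq (m<m+n a 1≤v))

*+*-positive : ∀ i e j n → (j ≡ 0 → 1 ≤ i × 1 ≤ e) → 1 ≤ i * e + j * suc n
*+*-positive i e zero    n j≡0⇒ = ≤-trans (uncurry *-mono-≤ (j≡0⇒ refl)) (m≤m+n (i * e) 0)
*+*-positive i e (suc j) n _    = ≤-trans (s≤s z≤n) (m≤n+m (suc j * suc n) (i * e))

overlap-family→family′ : ∀ {x} i j e₁ f → suc i + e₁ ≡ x → 1 ≤ i * e₁ + j * suc (suc i + f) →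
  tri i + (x + 1) + ((x + 3) * j + tri j) ≤
  suc (tri (suc i) + suc i * e₁ + ((x + 3) * j + tri j + j * suc (suc i + f)))
overlap-family→family′ i j e₁ f refl pos = ≤-from-excess pos (excess i j e₁ f (tri i) (tri j))
  where
  excess : ∀ i j e₁ f a b →
    a + (suc i + e₁ + 1) + ((suc i + e₁ + 3) * j + b) + (i * e₁ + j * suc (suc i + f)) ≡
    suc (suc (i + a + suc i * e₁ + ((suc i + e₁ + 3) * j + b + j * suc (suc i + f))))
  excess = solve-∀

overlap-family′→family : ∀ x i j e₁ f → 1 ≤ i * e₁ + j * suc (i + f) →
  tri i + ((x + 3) * suc j + tri (suc j)) ≤
  suc (tri i + i * e₁ + (x + 1) + ((x + 3) * j + tri j + j * suc (suc (i + f))))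
overlap-family′→family x i j e₁ f pos = ≤-from-excess pos (excess x i j e₁ f (tri i) (tri j))
  where
  excess : ∀ x i j e₁ f a b →
    a + ((x + 3) * suc j + (j + b)) + (i * e₁ + j * suc (i + f)) ≡
    suc (suc (a + i * e₁ + (x + 1) + ((x + 3) * j + b + j * suc (suc (i + f)))))
  excess = solve-∀

-- A = [0, x) ∪ {x + 1} ∪ [x + 3, k + 2).  The h-sets of family i j consist of i elements
-- of [0, x) and j elements of [x + 3, k + 2), those of family′ i j contain x + 1 as well;
-- e₁ is the number of elements of [0, x) left out.
module Families (x h f : ℕ) (2≤h : 2 ≤ h) where

  k : ℕ
  k = x + h + 2 + f

  A : Pred ℕ 0ℓ
  A = _∈ setA k x

  top : ℕ
  top = (x + 3) * h + tri h + h * suc f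

  x∉A : ¬ A x
  x∉A x∈A = proj₁ (proj₂ (∈-setA⁻ {k} x∈A)) refl

  x+2∉A : ¬ A (x + 2)
  x+2∉A x+2∈A = proj₂ (proj₂ (∈-setA⁻ {k} x+2∈A)) refl

  x≤k : x ≤ k
  x≤k = ≤-trans (m≤m+n x h) (≤-trans (m≤m+n (x + h) 2) (m≤m+n (x + h + 2) f))

  low⇒A : ∀ {y} → [ 0 , x ⟩ y → A y
  low⇒A (_ , y<x) =
    ∈-setA⁺ (≤-trans (<⇒≤ y<x) (≤-trans x≤k (m≤m+n k 1))) (<⇒≢ y<x) (<⇒≢ (<-≤-trans y<x (m≤m+n x 2)))

  mid⇒A : A (x + 1)
  mid⇒A = ∈-setA⁺ (+-monoˡ-≤ 1 x≤k) (m+1+n≢m x) (λ eq → case +-cancelˡ-≡ x 1 2 eq of λ ())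

  high⇒A : ∀ {y} → [ x + 3 , suc (k + 1) ⟩ y → A y
  high⇒A (x+3≤y , y<k+2) = ∈-setA⁺ (s≤s⁻¹ y<k+2)
    (≢-sym (<⇒≢ (<-≤-trans (m<m+n x (s≤s z≤n)) x+3≤y)))
    (≢-sym (<⇒≢ (<-≤-trans (+-monoʳ-< x (n<1+n 2)) x+3≤y)))

  high-end : ∀ i j → i + j ≡ h → x + 3 + j + suc (i + f) ≡ suc (k + 1)
  high-end i j ij≡h = trans (rearrange x i j f) (cong (λ n → suc (x + n + 2 + f + 1)) ij≡h)
    where
    rearrange : ∀ x i j f → x + 3 + j + suc (i + f) ≡ suc (x + (i + j) + 2 + f + 1)
    rearrange = solve-∀

  family : ∀ i j e₁ → i + e₁ ≡ x → i + j ≡ h →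
    Covers A h (tri i + ((x + 3) * j + tri j))
               (tri i + i * e₁ + ((x + 3) * j + tri j + j * suc (i + f)))
  family i j e₁ ie₁≡x ij≡h = subst (λ n → Covers A n _ _) ij≡h
    (Covers-map [ low⇒A ∘ [,⟩-mono ≤-refl (≤-reflexive ie₁≡x)
                , high⇒A ∘ [,⟩-mono ≤-refl (≤-reflexive (high-end i j ij≡h)) ]′
      (Covers-++ ([,⟩-< (≤-trans (≤-reflexive ie₁≡x) (m≤m+n x 3))) (m≤m+n _ _) (m≤m+n _ _)
        (Covers-[,⟩ 0 i e₁) (Covers-[,⟩ (x + 3) j (suc (i + f)))))

  family′ : ∀ i j e₁ → i + e₁ ≡ x → suc (i + j) ≡ h →
    Covers A h (tri i + (x + 1) + ((x + 3) * j + tri j))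
               (tri i + i * e₁ + (x + 1) + ((x + 3) * j + tri j + j * suc (suc (i + f))))
  family′ i j e₁ ie₁≡x ij≡h = subst (λ n → Covers A n _ _) (trans (cong (_+ j) (+-comm i 1)) ij≡h)
    (Covers-map [ [ low⇒A ∘ [,⟩-mono ≤-refl (≤-reflexive ie₁≡x) , (λ { refl → mid⇒A }) ]′
                , high⇒A ∘ [,⟩-mono ≤-refl (≤-reflexive (high-end (suc i) j ij≡h)) ]′
      (Covers-++ below-high (+-monoˡ-≤ (x + 1) (m≤m+n (tri i) (i * e₁))) (m≤m+n _ _)
        (Covers-++ low<mid (m≤m+n _ _) ≤-refl (Covers-[,⟩ 0 i e₁) (Covers-singleton {P = _≡ x + 1} refl))
        (Covers-[,⟩ (x + 3) j (suc (suc (i + f))))))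
    where
    low<mid : ∀ {y z} → [ 0 , i + e₁ ⟩ y → z ≡ x + 1 → y < z
    low<mid (_ , y<) refl = <-≤-trans y< (≤-trans (≤-reflexive ie₁≡x) (m≤m+n x 1))
    below-high : ∀ {y z} → ([ 0 , i + e₁ ⟩ ∪ (_≡ x + 1)) y →
                 [ x + 3 , x + 3 + j + suc (suc (i + f)) ⟩ z → y < z
    below-high (inj₁ y∈) = [,⟩-< (≤-trans (≤-reflexive ie₁≡x) (m≤m+n x 3)) y∈
    below-high (inj₂ refl) (x+3≤z , _) = <-≤-trans (+-monoʳ-< x (s≤s (s≤s z≤n))) x+3≤z

  low-count-positive : ∀ {i j} → suc (i + j) ≡ h → j ≡ 0 → 1 ≤ i
  low-count-positive {i} ij≡h refl =
    s≤s⁻¹ (≤-trans 2≤h (≤-reflexive (trans (sym ij≡h) (cong suc (+-identityʳ i)))))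

  -- family (i + 1) j, family′ i j, family i (j + 1), … overlap consecutively; when j = 0
  -- the overlap needs a spare element below x, hence the hypothesis on e₁.
  mutual
    chain : ∀ i j e₁ → i + e₁ ≡ x → i + j ≡ h → (j ≡ 0 → 1 ≤ e₁) →
            Covers A h (tri i + ((x + 3) * j + tri j)) top
    chain zero    j e₁ e₁≡x refl _ = family zero j e₁ e₁≡x refl
    chain (suc i) j e₁ ie₁≡x ij≡h j≡0⇒1≤e₁ =
      Covers-join (overlap-family→family′ i j e₁ f ie₁≡x (*+*-positive i e₁ j (suc i + f)
                                                    λ j≡0 → low-count-positive ij≡h j≡0 , j≡0⇒1≤e₁ j≡0))
        (family (suc i) j e₁ ie₁≡x ij≡h)
        (chain′ i j (suc e₁) (trans (+-suc i e₁) ie₁≡x) ij≡h λ _ → s≤s z≤n)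

    chain′ : ∀ i j e₁ → i + e₁ ≡ x → suc (i + j) ≡ h → (j ≡ 0 → 1 ≤ e₁) →
             Covers A h (tri i + (x + 1) + ((x + 3) * j + tri j)) top
    chain′ i j e₁ ie₁≡x ij≡h j≡0⇒1≤e₁ =
      Covers-join (overlap-family′→family x i j e₁ f (*+*-positive i e₁ j (i + f)
                                                λ j≡0 → low-count-positive ij≡h j≡0 , j≡0⇒1≤e₁ j≡0))
        (family′ i j e₁ ie₁≡x ij≡h)
        (chain i (suc j) e₁ ie₁≡x (trans (+-suc i j) ij≡h) λ ())

  top+tri≡ : top + tri h ≡ h * (k + 1)
  top+tri≡ = +-cancelʳ-≡ h _ _ (begin
    top + tri h + h                                ≡⟨ regroup ((x + 3) * h) (tri h) (h * suc f) h ⟩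
    (x + 3) * h + h * suc f + (tri h + tri h + h)  ≡⟨ cong (_+_ ((x + 3) * h + h * suc f)) (tri-double h) ⟩
    (x + 3) * h + h * suc f + h * h                ≡⟨ expand x h f ⟩
    h * (k + 1) + h                                ∎)
    where
    open ≡-Reasoning
    regroup : ∀ a t b h → a + t + b + t + h ≡ a + b + (t + t + h)
    regroup = solve-∀
    expand : ∀ x h f → (x + 3) * h + h * suc f + h * h ≡ h * (x + h + 2 + f + 1) + h
    expand = solve-∀

  Selection-≤top : ∀ {t} → Selection A h t → t ≤ top
  Selection-≤top sel = +-cancelʳ-≤ (tri h) _ _
    (≤-trans (Selection-sum+tri≤ (k + 1) (proj₁ ∘ ∈-setA⁻ {k} {x}) sel) (≤-reflexive (sym top+tri≡)))

  without-high : ∀ a → a + ((x + 3) * 0 + tri 0) ≡ a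
  without-high a = trans (cong (_+_ a) (trans (+-identityʳ _) (*-zeroʳ (x + 3)))) (+-identityʳ a)

  sums⁻ : ∀ {t} → t ∈ restrictedSumset h (setA k x) → Selection A h t
  sums⁻ = ∈-restrictedSumset⁻ (Unique-setA k x)

≤∧≢+1⇒≡∨+2≤ : ∀ {a t} → a ≤ t → t ≢ a + 1 → t ≡ a ⊎ a + 2 ≤ t
≤∧≢+1⇒≡∨+2≤ {a} a≤t t≢a+1 with m≤n⇒m<n∨m≡n a≤t
... | inj₂ refl = inj₁ refl
... | inj₁ a<t with m≤n⇒m<n∨m≡n a<t
...   | inj₂ refl  = contradiction (+-comm 1 a) t≢a+1
...   | inj₁ a+1<t = inj₂ (≤-trans (≤-reflexive (+-comm a 2)) a+1<t)

card-i : ∀ x h k → x + 2 ≤ h → x + h + 2 ≤ k → card-hA h (setA k x) + h * h ≡ h * k + (x + x + 2)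
card-i x _ _ x+2≤h x+h+2≤k with o , refl ← m≤n⇒∃[o]m+o≡n x+2≤h
  with f , refl ← m≤n⇒∃[o]m+o≡n x+h+2≤k =
  trans (cong (_+ h * h) (card-hA-range h (setA k x) (mk⇔ to from))) (count x h f)
  where
  h : ℕ
  h = x + 2 + o
  open Families x h f (m+n≤o⇒n≤o x x+2≤h)
  count : ∀ x h f → h * (x + 2 + f) + (x + x) + 2 + h * h ≡ h * (x + h + 2 + f) + (x + x + 2)
  count = solve-∀
  L : ℕ
  L = tri x + (x + 1) + ((x + 3) * suc o + tri (suc o))
  n : ℕ
  n = h * (x + 2 + f) + (x + x) + 2
  tri-h : tri h ≡ tri x + tri (2 + o) + x * (2 + o)
  tri-h = trans (cong tri (+-assoc x 2 o)) (tri-+ x (2 + o))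
  top-eq : L + n ≡ suc top
  top-eq = trans (rearrange x o f (tri x) (tri o))
                 (cong (λ t → suc ((x + 3) * h + t + h * suc f)) (sym tri-h))
    where
    rearrange : ∀ x o f a b →
      a + (x + 1) + ((x + 3) * suc o + (o + b)) + ((x + 2 + o) * (x + 2 + f) + (x + x) + 2) ≡
      suc ((x + 3) * (x + 2 + o) + (a + (suc o + (o + b)) + x * (2 + o)) + (x + 2 + o) * suc f)
    rearrange = solve-∀
  to : ∀ {t} → t ∈ restrictedSumset h (setA k x) → [ L , L + n ⟩ t
  to {t} t∈ = L≤t , ≤-trans (s≤s (Selection-≤top (sums⁻ t∈))) (≤-reflexive (sym top-eq))
    where
    with-gap : Selection ((A ∪ (_≡ x)) ∪ (_≡ x + 2)) (suc (suc h)) (x + 2 + (x + t))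
    with-gap = Selection-∷ [ x+2∉A , m+1+n≢m x ]′ (Selection-∷ x∉A (sums⁻ t∈))
    L≤t : L ≤ t
    L≤t = +-cancelʳ-≤ (x + 2 + x) _ _ (begin
      L + (x + 2 + x)                                     ≡⟨ rearrange x o (tri x) (tri o) ⟩
      suc h + (h + (tri x + tri (2 + o) + x * (2 + o)))   ≡⟨ cong (λ s → suc h + (h + s)) tri-h ⟨
      tri (suc (suc h))                                   ≤⟨ Selection-tri≤ with-gap ⟩
      x + 2 + (x + t)                                     ≡⟨ +-assoc (x + 2) x t ⟨
      x + 2 + x + t                                       ≡⟨ +-comm (x + 2 + x) t ⟩
      t + (x + 2 + x)                                     ∎)
      where
      open ≤-Reasoning
      rearrange : ∀ x o a b → a + (x + 1) + ((x + 3) * suc o + (o + b)) + (x + 2 + x) ≡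
                              suc (x + 2 + o) + (x + 2 + o + (a + (suc o + (o + b)) + x * (2 + o)))
      rearrange = solve-∀
  from : ∀ {t} → [ L , L + n ⟩ t → t ∈ restrictedSumset h (setA k x)
  from (L≤t , t<) = ∈-restrictedSumset⁺ (chain′ x (suc o) 0 (+-identityʳ x) (size x o) (λ ())
    L≤t (s≤s⁻¹ (<-≤-trans t< (≤-reflexive top-eq))))
    where
    size : ∀ x o → suc (x + suc o) ≡ x + 2 + o
    size = solve-∀

card-iii : ∀ x k → 1 ≤ x → x + suc x + 2 ≤ k →
           card-hA (suc x) (setA k x) + suc x * suc x ≡ suc x * k + (suc x + x)
card-iii x _ 1≤x x+h+2≤k with f , refl ← m≤n⇒∃[o]m+o≡n x+h+2≤k =
  trans (cong (_+ suc x * suc x) (card-hA-point+range h (setA k x) (mk⇔ to from))) (count x f)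
  where
  h : ℕ
  h = suc x
  open Families x h f (s≤s 1≤x)
  a : ℕ
  a = x + tri x + 1
  n : ℕ
  n = h * (x + 2 + f) + x + x
  count : ∀ x f → suc (suc x * (x + 2 + f) + x + x) + suc x * suc x ≡
                  suc x * (x + suc x + 2 + f) + (suc x + x)
  count = solve-∀
  top-eq : a + 2 + n ≡ suc top
  top-eq = rearrange x f (tri x)
    where
    rearrange : ∀ x f t → x + t + 1 + 2 + (suc x * (x + 2 + f) + x + x) ≡
                          suc ((x + 3) * suc x + (x + t) + suc x * suc f)
    rearrange = solve-∀
  with-x : ∀ {t} → t ∈ restrictedSumset h (setA k x) → Selection (A ∪ (_≡ x)) (suc h) (x + t)
  with-x t∈ = Selection-∷ x∉A (sums⁻ t∈)
  lower-eq : ∀ x t → x + (x + t + 1) ≡ suc x + (x + t)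
  lower-eq = solve-∀
  gap-eq : ∀ x t → x + (x + t + 1 + 1) ≡ suc x + (x + t) + 1
  gap-eq = solve-∀
  a≤ : ∀ {t} → t ∈ restrictedSumset h (setA k x) → a ≤ t
  a≤ t∈ = +-cancelˡ-≤ x _ _ (≤-trans (≤-reflexive (lower-eq x (tri x))) (Selection-tri≤ (with-x t∈)))
  ≢a+1 : ∀ {t} → t ∈ restrictedSumset h (setA k x) → t ≢ a + 1
  ≢a+1 t∈ refl with Selection-sum≡tri+1⇒P (with-x t∈) (gap-eq x (tri x))
  ... | inj₁ x+2∈A = x+2∉A (subst A (+-comm 2 x) x+2∈A)
  ... | inj₂ x+2≡x = m+1+n≢m x (trans (+-comm x 2) x+2≡x)
  to : ∀ {t} → t ∈ restrictedSumset h (setA k x) → t ≡ a ⊎ [ a + 2 , a + 2 + n ⟩ t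
  to t∈ with ≤∧≢+1⇒≡∨+2≤ (a≤ t∈) (≢a+1 t∈)
  ... | inj₁ t≡a   = inj₁ t≡a
  ... | inj₂ a+2≤t = inj₂ (a+2≤t , ≤-trans (s≤s (Selection-≤top (sums⁻ t∈))) (≤-reflexive (sym top-eq)))
  from : ∀ {t} → t ≡ a ⊎ [ a + 2 , a + 2 + n ⟩ t → t ∈ restrictedSumset h (setA k x)
  from (inj₁ refl) = ∈-restrictedSumset⁺ (family′ x 0 0 (+-identityʳ x) (cong suc (+-identityʳ x))
    (≤-reflexive (lo-eq x (tri x))) (≤-reflexive (sym (hi-eq x (tri x)))))
    where
    lo-eq : ∀ x t → t + (x + 1) + ((x + 3) * 0 + 0) ≡ x + t + 1
    lo-eq = solve-∀
    hi-eq : ∀ x t → t + x * 0 + (x + 1) + ((x + 3) * 0 + 0 + 0) ≡ x + t + 1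
    hi-eq = solve-∀
  from (inj₂ (lo≤t , t<)) = ∈-restrictedSumset⁺ (chain x 1 0 (+-identityʳ x) (+-comm x 1) (λ ())
    (≤-trans (≤-reflexive (rearrange x (tri x))) lo≤t) (s≤s⁻¹ (<-≤-trans t< (≤-reflexive top-eq))))
    where
    rearrange : ∀ x t → t + ((x + 3) * 1 + 0) ≡ x + t + 1 + 2
    rearrange = solve-∀

card-iv : ∀ h k → 2 ≤ h → h + h + 2 ≤ k → card-hA h (setA k h) + h * h ≡ h * k + (h + h)
card-iv h@(suc g) _ 2≤h h+h+2≤k with f , refl ← m≤n⇒∃[o]m+o≡n h+h+2≤k =
  trans (cong (_+ h * h) (card-hA-point+range h (setA k h) (mk⇔ to from))) (count g f)
  where
  open Families h h f 2≤h
  n : ℕ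
  n = h * (h + 2 + f) + g + suc g
  count : ∀ g f → suc (suc g * (suc g + 2 + f) + g + suc g) + suc g * suc g ≡
                  suc g * (suc g + suc g + 2 + f) + (suc g + suc g)
  count = solve-∀
  top-eq : tri h + 2 + n ≡ suc top
  top-eq = rearrange g f (tri h)
    where
    rearrange : ∀ g f t → t + 2 + (suc g * (suc g + 2 + f) + g + suc g) ≡
                          suc ((suc g + 3) * suc g + t + suc g * suc f)
    rearrange = solve-∀
  to : ∀ {t} → t ∈ restrictedSumset h (setA k h) → t ≡ tri h ⊎ [ tri h + 2 , tri h + 2 + n ⟩ t
  to t∈ with ≤∧≢+1⇒≡∨+2≤ (Selection-tri≤ (sums⁻ t∈)) (x∉A ∘ Selection-sum≡tri+1⇒P (sums⁻ t∈))
  ... | inj₁ t≡ = inj₁ t≡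
  ... | inj₂ ≤t = inj₂ (≤t , ≤-trans (s≤s (Selection-≤top (sums⁻ t∈))) (≤-reflexive (sym top-eq)))
  from : ∀ {t} → t ≡ tri h ⊎ [ tri h + 2 , tri h + 2 + n ⟩ t → t ∈ restrictedSumset h (setA k h)
  from (inj₁ refl) = ∈-restrictedSumset⁺
    (Selection-map (low⇒A ∘ [,⟩-mono ≤-refl (≤-reflexive (+-identityʳ h)))
      (Covers-[,⟩ 0 h 0 ≤-refl (m≤m+n (tri h) (h * 0))))
  from (inj₂ (lo≤t , t<)) = ∈-restrictedSumset⁺
    (chain′ g 0 1 (+-comm g 1) (cong suc (+-identityʳ g)) (λ _ → ≤-refl)
      (≤-trans (≤-reflexive (trans (without-high _) (rearrange g (tri g)))) lo≤t)
      (s≤s⁻¹ (<-≤-trans t< (≤-reflexive top-eq))))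
    where
    rearrange : ∀ g t → t + (suc g + 1) ≡ g + t + 2
    rearrange = solve-∀

card-v : ∀ x h k → 2 ≤ h → h < x → x + h + 2 ≤ k →
         card-hA h (setA k x) + h * h ≡ h * k + (h + h + 1)
card-v x h _ 2≤h h<x x+h+2≤k
  with f , refl ← m≤n⇒∃[o]m+o≡n x+h+2≤k | o , 1+h+o≡x ← m≤n⇒∃[o]m+o≡n h<x =
  trans (cong (_+ h * h) (card-hA-range h (setA k x) (mk⇔ to from))) (count x h f)
  where
  open Families x h f 2≤h
  count : ∀ x h f → h * (x + 2 + f) + (h + h) + 1 + h * h ≡ h * (x + h + 2 + f) + (h + h + 1)
  count = solve-∀
  n : ℕ
  n = h * (x + 2 + f) + (h + h) + 1
  top-eq : tri h + n ≡ suc top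
  top-eq = rearrange x h f (tri h)
    where
    rearrange : ∀ x h f t → t + (h * (x + 2 + f) + (h + h) + 1) ≡ suc ((x + 3) * h + t + h * suc f)
    rearrange = solve-∀
  to : ∀ {t} → t ∈ restrictedSumset h (setA k x) → [ tri h , tri h + n ⟩ t
  to t∈ = Selection-tri≤ (sums⁻ t∈) , ≤-trans (s≤s (Selection-≤top (sums⁻ t∈))) (≤-reflexive (sym top-eq))
  from : ∀ {t} → [ tri h , tri h + n ⟩ t → t ∈ restrictedSumset h (setA k x)
  from (lo≤t , t<) = ∈-restrictedSumset⁺
    (chain h 0 (suc o) (trans (+-suc h o) 1+h+o≡x) (+-identityʳ h) (λ _ → s≤s z≤n)
      (≤-trans (≤-reflexive (without-high (tri h))) lo≤t) (s≤s⁻¹ (<-≤-trans t< (≤-reflexive top-eq))))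

m+n≡o⇒ℤ : ∀ {n a b} → n + b ≡ a → + n ≡ + a - + b
m+n≡o⇒ℤ {n} {b = b} refl = sym (cancel (+ n) (+ b))
  where
  cancel : ∀ n b → n ℤ.+ b - b ≡ n
  cancel = ℤ-Solver.solve-∀

m+h*h≡h*k+c⇒ℤ : ∀ {n} h k c → n + h * h ≡ h * k + c → + n ≡ + h ℤ.* + k - + h ℤ.* + h ℤ.+ + c
m+h*h≡h*k+c⇒ℤ {n} h k c eq = begin
  + n                                 ≡⟨ m+n≡o⇒ℤ eq ⟩
  + (h * k) ℤ.+ + c - + (h * h)       ≡⟨ cong₂ (λ a b → a ℤ.+ + c - b) (ℤₚ.pos-* h k) (ℤₚ.pos-* h h) ⟩
  + h ℤ.* + k ℤ.+ + c - + h ℤ.* + h   ≡⟨ regroup (+ h ℤ.* + k) (+ c) (+ h ℤ.* + h) ⟩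
  + h ℤ.* + k - + h ℤ.* + h ℤ.+ + c   ∎
  where
  open ≡-Reasoning
  regroup : ∀ a c b → a ℤ.+ c - b ≡ a - b ℤ.+ c
  regroup = ℤ-Solver.solve-∀

3m+3≤n⇒m+m+2≤n : ∀ m {n} → 3 * m + 3 ≤ n → m + m + 2 ≤ n
3m+3≤n⇒m+m+2≤n m 3m+3≤n = ≤-trans (+-mono-≤ (+-monoʳ-≤ m (m≤m+n m (m + 0))) (n≤1+n 2)) 3m+3≤n

∸+1≤⇒+1≤+ : ∀ {h k x} → h ≤ k → k ∸ h + 1 ≤ x → k + 1 ≤ x + h
∸+1≤⇒+1≤+ {h} {k} {x} h≤k k∸h+1≤x = begin
  k + 1          ≡⟨ cong (_+ 1) (m∸n+n≡m h≤k) ⟨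
  k ∸ h + h + 1  ≡⟨ xy∙z≈xz∙y (k ∸ h) h 1 ⟩
  k ∸ h + 1 + h  ≤⟨ +-monoˡ-≤ h k∸h+1≤x ⟩
  x + h          ∎
  where open ≤-Reasoning

part-i : ∀ {h k x} → 3 ≤ h → 3 * h + 3 ≤ k → x ≤ h ∸ 2 →
         + card-hA h (setA k x) ≡ + h ℤ.* + k - + h ℤ.* + h ℤ.+ + 2 ℤ.* + x ℤ.+ + 2
part-i {h} {k} {x} 3≤h 3h+3≤k x≤h∸2 = trans
  (m+h*h≡h*k+c⇒ℤ h k (x + x + 2) (card-i x h k x+2≤h
    (≤-trans (+-monoˡ-≤ 2 (+-monoˡ-≤ h (m+n≤o⇒m≤o x x+2≤h))) (3m+3≤n⇒m+m+2≤n h 3h+3≤k))))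
  (regroup (+ h ℤ.* + k - + h ℤ.* + h) (+ x))
  where
  x+2≤h : x + 2 ≤ h
  x+2≤h = m≤o∸n⇒m+n≤o x (≤-trans (n≤1+n 2) 3≤h) x≤h∸2
  regroup : ∀ a x → a ℤ.+ (x ℤ.+ x ℤ.+ + 2) ≡ a ℤ.+ + 2 ℤ.* x ℤ.+ + 2
  regroup = ℤ-Solver.solve-∀

card-ii : ∀ h k x → 3 * h + 3 ≤ k → k ∸ h + 1 ≤ x → x ≤ k ∸ 2 →
          card-hA h (setA k x) + (h * h + (x + x)) ≡ (h + 2) * k
card-ii h _ x 3h+3≤k k∸h+1≤x x≤k∸2
  with x′ , refl ← m≤n⇒∃[o]m+o≡n (≤-trans (+-monoʳ-≤ x (n≤1+n 1))
                     (m≤o∸n⇒m+n≤o x (m+n≤o⇒n≤o (h + h) (3m+3≤n⇒m+m+2≤n h 3h+3≤k)) x≤k∸2)) = begin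
  card-hA h (setA k x) + (h * h + (x + x))   ≡⟨ cong (_+ (h * h + (x + x)))
                                                     (card-hA-reflect h k x x′ (xy∙z≈xz∙y x x′ 1)) ⟩
  card-hA h (setA k x′) + (h * h + (x + x))  ≡⟨ +-assoc (card-hA h (setA k x′)) (h * h) (x + x) ⟨
  card-hA h (setA k x′) + h * h + (x + x)    ≡⟨ cong (_+ (x + x)) (card-i x′ h k x′+2≤h x′+h+2≤k) ⟩
  h * k + (x′ + x′ + 2) + (x + x)            ≡⟨ rearrange h x x′ ⟩
  (h + 2) * k                                ∎
  where
  open ≡-Reasoning
  k : ℕ
  k = x + 1 + x′
  h+h+2≤k : h + h + 2 ≤ k
  h+h+2≤k = 3m+3≤n⇒m+m+2≤n h 3h+3≤k
  rearrange : ∀ h x x′ → h * (x + 1 + x′) + (x′ + x′ + 2) + (x + x) ≡ (h + 2) * (x + 1 + x′)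
  rearrange = solve-∀
  k+1≤x+h : k + 1 ≤ x + h
  k+1≤x+h = ∸+1≤⇒+1≤+ (≤-trans (m≤m+n h h) (m+n≤o⇒m≤o (h + h) h+h+2≤k)) k∸h+1≤x
  x′+2≤h : x′ + 2 ≤ h
  x′+2≤h = +-cancelˡ-≤ x _ _ (≤-trans (≤-reflexive (regroup x x′)) k+1≤x+h)
    where
    regroup : ∀ x x′ → x + (x′ + 2) ≡ x + 1 + x′ + 1
    regroup = solve-∀
  h+1≤x : h + 1 ≤ x
  h+1≤x = +-cancelʳ-≤ h _ _
    (≤-trans (≤-reflexive (xy∙z≈xz∙y h 1 h)) (≤-trans (+-monoˡ-≤ 1 (m+n≤o⇒m≤o (h + h) h+h+2≤k)) k+1≤x+h))
  x′+h+2≤k : x′ + h + 2 ≤ k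
  x′+h+2≤k = ≤-trans (≤-reflexive (regroup x′ h))
    (≤-trans (+-monoʳ-≤ x′ (+-monoˡ-≤ 1 h+1≤x)) (≤-reflexive (+-comm x′ (x + 1))))
    where
    regroup : ∀ x′ h → x′ + h + 2 ≡ x′ + (h + 1 + 1)
    regroup = solve-∀

part-ii : ∀ h {k x} → 3 * h + 3 ≤ k → k ∸ h + 1 ≤ x → x ≤ k ∸ 2 →
          + card-hA h (setA k x) ≡ (+ h ℤ.+ + 2) ℤ.* + k - + h ℤ.* + h - + 2 ℤ.* + x
part-ii h {k} {x} 3h+3≤k k∸h+1≤x x≤k∸2 = begin
  + card-hA h (setA k x)                               ≡⟨ m+n≡o⇒ℤ (card-ii h k x 3h+3≤k k∸h+1≤x x≤k∸2) ⟩
  + ((h + 2) * k) - (+ (h * h) ℤ.+ + (x + x))          ≡⟨ cong₂ (λ a b → a - (b ℤ.+ + (x + x)))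
                                                                (ℤₚ.pos-* (h + 2) k) (ℤₚ.pos-* h h) ⟩
  (+ h ℤ.+ + 2) ℤ.* + k - (+ h ℤ.* + h ℤ.+ + (x + x))  ≡⟨ regroup (+ h) (+ k) (+ x) ⟩
  (+ h ℤ.+ + 2) ℤ.* + k - + h ℤ.* + h - + 2 ℤ.* + x    ∎
  where
  open ≡-Reasoning
  regroup : ∀ h k x → (h ℤ.+ + 2) ℤ.* k - (h ℤ.* h ℤ.+ (x ℤ.+ x)) ≡
                      (h ℤ.+ + 2) ℤ.* k - h ℤ.* h - + 2 ℤ.* x
  regroup = ℤ-Solver.solve-∀

part-iii : ∀ {h k x} → 3 ≤ h → 3 * h + 3 ≤ k → x ≡ h ∸ 1 ⊎ x ≡ k ∸ h →
           + card-hA h (setA k x) ≡ + h ℤ.* + k - + h ℤ.* + h ℤ.+ + 2 ℤ.* + h - + 1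
part-iii {h@(suc g)} {k} {x} (s≤s 2≤g) 3h+3≤k x≡ = begin
  + card-hA h (setA k x)                          ≡⟨ cong +_ (same-card x≡) ⟩
  + card-hA h (setA k g)                          ≡⟨ m+h*h≡h*k+c⇒ℤ h k (h + g)
                                                       (card-iii g k (≤-trans (n≤1+n 1) 2≤g) g+h+2≤k) ⟩
  + h ℤ.* + k - + h ℤ.* + h ℤ.+ + (h + g)         ≡⟨ regroup (+ g) (+ k) ⟩
  + h ℤ.* + k - + h ℤ.* + h ℤ.+ + 2 ℤ.* + h - + 1 ∎
  where
  open ≡-Reasoning
  h+h+2≤k : h + h + 2 ≤ k
  h+h+2≤k = 3m+3≤n⇒m+m+2≤n h 3h+3≤k
  g+h+2≤k : g + h + 2 ≤ k
  g+h+2≤k = ≤-trans (+-monoˡ-≤ 2 (+-monoˡ-≤ h (n≤1+n g))) h+h+2≤k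
  same-card : ∀ {y} → y ≡ g ⊎ y ≡ k ∸ h → card-hA h (setA k y) ≡ card-hA h (setA k g)
  same-card (inj₁ refl) = refl
  same-card (inj₂ refl) = card-hA-reflect h k (k ∸ h) g (trans (+-assoc (k ∸ h) g 1)
    (trans (cong (_+_ (k ∸ h)) (+-comm g 1)) (m∸n+n≡m (m+n≤o⇒m≤o h (≤-trans (m≤m+n (h + h) 2) h+h+2≤k)))))
  regroup : ∀ g k → (+ 1 ℤ.+ g) ℤ.* k - (+ 1 ℤ.+ g) ℤ.* (+ 1 ℤ.+ g) ℤ.+ ((+ 1 ℤ.+ g) ℤ.+ g) ≡
                    (+ 1 ℤ.+ g) ℤ.* k - (+ 1 ℤ.+ g) ℤ.* (+ 1 ℤ.+ g) ℤ.+ + 2 ℤ.* (+ 1 ℤ.+ g) - + 1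
  regroup = ℤ-Solver.solve-∀

part-iv : ∀ {h k x} → 3 ≤ h → 3 * h + 3 ≤ k → x ≡ h ⊎ x ≡ k ∸ h ∸ 1 →
          + card-hA h (setA k x) ≡ + h ℤ.* + k - + h ℤ.* + h ℤ.+ + 2 ℤ.* + h
part-iv {h} {k} {x} 3≤h 3h+3≤k x≡ = begin
  + card-hA h (setA k x)                      ≡⟨ cong +_ (same-card x≡) ⟩
  + card-hA h (setA k h)                      ≡⟨ m+h*h≡h*k+c⇒ℤ h k (h + h)
                                                   (card-iv h k (≤-trans (n≤1+n 2) 3≤h) h+h+2≤k) ⟩
  + h ℤ.* + k - + h ℤ.* + h ℤ.+ + (h + h)     ≡⟨ regroup (+ h ℤ.* + k - + h ℤ.* + h) (+ h) ⟩
  + h ℤ.* + k - + h ℤ.* + h ℤ.+ + 2 ℤ.* + h   ∎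
  where
  open ≡-Reasoning
  h+h+2≤k : h + h + 2 ≤ k
  h+h+2≤k = 3m+3≤n⇒m+m+2≤n h 3h+3≤k
  h+1≤k : h + 1 ≤ k
  h+1≤k = ≤-trans (+-monoˡ-≤ 1 (m≤n+m h h))
            (m+n≤o⇒m≤o (h + h + 1) (≤-trans (≤-reflexive (+-assoc (h + h) 1 1)) h+h+2≤k))
  same-card : ∀ {y} → y ≡ h ⊎ y ≡ k ∸ h ∸ 1 → card-hA h (setA k y) ≡ card-hA h (setA k h)
  same-card (inj₁ refl) = refl
  same-card (inj₂ refl) = card-hA-reflect h k (k ∸ h ∸ 1) h
    (trans (cong (λ m → m + h + 1) (∸-+-assoc k h 1)) (trans (+-assoc (k ∸ (h + 1)) h 1) (m∸n+n≡m h+1≤k)))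
  regroup : ∀ a h → a ℤ.+ (h ℤ.+ h) ≡ a ℤ.+ + 2 ℤ.* h
  regroup = ℤ-Solver.solve-∀

part-v : ∀ {h k x} → 3 ≤ h → 3 * h + 3 ≤ k → h + 1 ≤ x → x ≤ k ∸ h ∸ 2 →
         + card-hA h (setA k x) ≡ + h ℤ.* + k - + h ℤ.* + h ℤ.+ + 2 ℤ.* + h ℤ.+ + 1
part-v {h} {k} {x} 3≤h 3h+3≤k h+1≤x x≤k∸h∸2 = trans
  (m+h*h≡h*k+c⇒ℤ h k (h + h + 1)
    (card-v x h k (≤-trans (n≤1+n 2) 3≤h) (≤-trans (≤-reflexive (+-comm 1 h)) h+1≤x) x+h+2≤k))
  (regroup (+ h ℤ.* + k - + h ℤ.* + h) (+ h))
  where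
  h+2≤k : h + 2 ≤ k
  h+2≤k = m+n≤o⇒n≤o h (≤-trans (≤-reflexive (sym (+-assoc h h 2))) (3m+3≤n⇒m+m+2≤n h 3h+3≤k))
  x+h+2≤k : x + h + 2 ≤ k
  x+h+2≤k = ≤-trans (≤-reflexive (+-assoc x h 2))
              (m≤o∸n⇒m+n≤o x h+2≤k (≤-trans x≤k∸h∸2 (≤-reflexive (∸-+-assoc k h 2))))
  regroup : ∀ a h → a ℤ.+ (h ℤ.+ h ℤ.+ + 1) ≡ a ℤ.+ + 2 ℤ.* h ℤ.+ + 1
  regroup = ℤ-Solver.solve-∀

proposition2p3 : (h k x : ℕ) → 3 ≤ h → 3 Data.Nat.* h Data.Nat.+ 3 ≤ k → 1 ≤ x → x ≤ k ∸ 2 →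
    ((1 ≤ x → x ≤ h ∸ 2 →
        + card-hA h (setA k x) ≡ + h Data.Integer.* + k - + h Data.Integer.* + h Data.Integer.+ + 2 Data.Integer.* + x Data.Integer.+ + 2)
    × (k ∸ h Data.Nat.+ 1 ≤ x → x ≤ k ∸ 2 →
        + card-hA h (setA k x) ≡ (+ h Data.Integer.+ + 2) Data.Integer.* + k - + h Data.Integer.* + h - + 2 Data.Integer.* + x)
    × (x ≡ h ∸ 1 ⊎ x ≡ k ∸ h →
        + card-hA h (setA k x) ≡ + h Data.Integer.* + k - + h Data.Integer.* + h Data.Integer.+ + 2 Data.Integer.* + h - + 1)
    × (x ≡ h ⊎ x ≡ k ∸ h ∸ 1 →
        + card-hA h (setA k x) ≡ + h Data.Integer.* + k - + h Data.Integer.* + h Data.Integer.+ + 2 Data.Integer.* + h)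
    × (h Data.Nat.+ 1 ≤ x → x ≤ k ∸ h ∸ 2 →
        + card-hA h (setA k x) ≡ + h Data.Integer.* + k - + h Data.Integer.* + h Data.Integer.+ + 2 Data.Integer.* + h Data.Integer.+ + 1))
proposition2p3 h _ _ 3≤h 3h+3≤k _ _ =
    (λ _ → part-i 3≤h 3h+3≤k)
  , part-ii h 3h+3≤k
  , part-iii 3≤h 3h+3≤k
  , part-iv 3≤h 3h+3≤k
  , part-v 3≤h 3h+3≤k
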